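{- Consider the non-preemptive variant, let $T>0$ and let $\sigma$ be a feasible non-preemptive schedule with makespan $T$. Then $\sigma$ needs at least $m_i$ different machines to schedule the jobs of class $i$, for every $i\in[c]$, and in total $\sigma$ needs at least $\sum_{i=1}^cm_i$ different machines.
   Context: An instance consists of $m$ identical machines, jobs $J$ partitioned into nonempty classes $C_1,\dots,C_c$, processing times $t_j\in\mathbb{N}$, setup times $s_i\in\mathbb{N}$; each machine processes one item at a time; a setup of class $i$ (length $s_i$, never preempted) is required whenever a machine starts processing jobs of class $i$ or switches to class $i$ from a different class; each job runs uninterrupted on a single machine. $P(K)=\sum_{j\in K}t_j$. Expensive classes $I_{\exp}=\{i:s_i>T/2\}$, cheap classes $I_{\mathrm{chp}}=\{i:s_i\le T/2\}$. $J_+=\{j:t_j>T/2\}$, $J_-=\{j:t_j\le T/2\}$, $K=\bigcup_{i\in I_{\mathrm{chp}}}\{j\in C_i\cap J_-:s_i+t_j>T/2\}$. $m_i=\lceil P(C_i)/(T-s_i)\rceil$ for $i\in I_{\exp}$ and $m_i=|C_i\cap J_+|+\lceil P(C_i\cap K)/(T-s_i)\rceil$ for $i\in I_{\mathrm{chp}}$. -}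

module Defs where

open import Data.Nat as ℕ using (ℕ)
open import Data.Integer as ℤ using (ℤ; +_; 0ℤ)
open import Data.Rational using (ℚ; 0ℚ; ½; _+_; _*_; _-_; _÷_; _≤_; _<_; _/_; >-nonZero; ceiling)
open import Data.Rational.Properties using (_≤?_; _<?_)
open import Data.Fin using (Fin)
open import Data.Fin.Properties using (any?) renaming (_≟_ to _≟ᶠ_)
open import Data.List using (List; allFin; filter; length; map; foldr)
open import Data.Product using (Σ; ∃; _×_; _,_)
open import Data.Sum using (_⊎_; inj₁; inj₂)
open import Data.Bool using (Bool; true; false; if_then_else_; _∧_; not)
open import Relation.Nullary using (Dec; yes; no; does; ¬_)
open import Relation.Binary.PropositionalEquality using (_≡_)

ℕ→ℚ : ℕ → ℚ
ℕ→ℚ k = (+ k) / 1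

-- ⌈ p / q ⌉ for q > 0; (convention: 0 when q ≤ 0, where p/q is undefined)
ceilDiv : ℚ → ℚ → ℤ
ceilDiv p q with 0ℚ <? q
... | yes q>0 = ceiling ((p ÷ q) {{>-nonZero q>0}})
... | no  _   = 0ℤ

sumℚ : (n : ℕ) → (Fin n → ℚ) → ℚ
sumℚ n f = foldr _+_ 0ℚ (map f (allFin n))

sumℤ : (c : ℕ) → (Fin c → ℤ) → ℤ
sumℤ c f = foldr ℤ._+_ 0ℤ (map f (allFin c))

countB : (n : ℕ) → (Fin n → Bool) → ℕ
countB n b = length (filter (λ x → b x ≟b true) (allFin n))
  where
  open import Data.Bool.Properties using () renaming (_≟_ to _≟b_)

-- An instance: m identical machines, n jobs, c classes; class of each job,
-- processing times t_j, setup times s_i; every class is nonempty.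
record Instance : Set where
  field
    m n c    : ℕ
    cls      : Fin n → Fin c
    t        : Fin n → ℕ
    s        : Fin c → ℕ
    nonempty : (i : Fin c) → ∃ λ j → cls j ≡ i

-- A (candidate) non-preemptive schedule: each job j runs uninterrupted on
-- machine mach j from time start j; in addition there are nset setups, setup k
-- being of class scls k, on machine smach k, starting at sstart k.
record Schedule (I : Instance) : Set where
  open Instance I
  field
    mach   : Fin n → Fin m
    start  : Fin n → ℚ
    nset   : ℕ
    smach  : Fin nset → Fin m
    scls   : Fin nset → Fin c
    sstart : Fin nset → ℚ

module _ {I : Instance} (σ : Schedule I) where
  open Instance I
  open Schedule σ

  Item : Set
  Item = Fin n ⊎ Fin nset

  iMach : Item → Fin m
  iMach (inj₁ j) = mach j
  iMach (inj₂ k) = smach k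

  iClass : Item → Fin c
  iClass (inj₁ j) = cls j
  iClass (inj₂ k) = scls k

  iStart : Item → ℚ
  iStart (inj₁ j) = start j
  iStart (inj₂ k) = sstart k

  iLen : Item → ℚ
  iLen (inj₁ j) = ℕ→ℚ (t j)
  iLen (inj₂ k) = ℕ→ℚ (s (scls k))

  iEnd : Item → ℚ
  iEnd x = iStart x + iLen x

  FeasibleWithMakespan : ℚ → Set
  FeasibleWithMakespan T =
      ((x : Item) → (0ℚ ≤ iStart x) × (iEnd x ≤ T))
    × ((x y : Item) → ¬ (x ≡ y) → iMach x ≡ iMach y →
         (iEnd x ≤ iStart y) ⊎ (iEnd y ≤ iStart x))
      -- setup requirement: before each job j there is a setup of its class on
      -- its machine, and everything processed on that machine between this
      -- setup and j belongs to the same class (no switch to another class)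
    × ((j : Fin n) → Σ (Fin nset) λ k →
         (smach k ≡ mach j) × (scls k ≡ cls j) × (iEnd (inj₂ k) ≤ start j)
         × ((y : Item) → iMach y ≡ mach j → iEnd (inj₂ k) ≤ iStart y →
              iStart y < start j → iClass y ≡ cls j))
    × (Σ Item λ x → iEnd x ≡ T)

  usesFor : Fin c → Fin m → Bool
  usesFor i μ = does (any? (λ j → (cls j ≟ᶠ i) ×-dec (mach j ≟ᶠ μ)))
    where open import Relation.Nullary.Decidable using (_×-dec_)

  uses : Fin m → Bool
  uses μ = does (any? (λ j → mach j ≟ᶠ μ))

  machinesFor : Fin c → ℕ
  machinesFor i = countB m (usesFor i)

  machinesUsed : ℕ
  machinesUsed = countB m uses

module _ (I : Instance) (T : ℚ) where
  open Instance I

  expensive : Fin c → Bool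
  expensive i = does ((T * ½) <? ℕ→ℚ (s i))

  big : Fin n → Bool
  big j = does ((T * ½) <? ℕ→ℚ (t j))

  inK : Fin n → Bool
  inK j = not (expensive (cls j)) ∧ not (big j)
          ∧ does ((T * ½) <? (ℕ→ℚ (s (cls j)) + ℕ→ℚ (t j)))

  loadIn : Fin c → (Fin n → Bool) → ℚ
  loadIn i L = sumℚ n (λ j →
    if does (cls j ≟ᶠ i) ∧ L j then ℕ→ℚ (t j) else 0ℚ)

  mBound : Fin c → ℤ
  mBound i with expensive i
  ... | true  = ceilDiv (loadIn i (λ _ → true)) (T - ℕ→ℚ (s i))
  ... | false = + countB n (λ j → does (cls j ≟ᶠ i) ∧ big j)
                ℤ.+ ceilDiv (loadIn i inK) (T - ℕ→ℚ (s i))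

module Submission where

-- Call a job large when its setup time plus its processing time exceeds T/2. Every job
-- runs after a setup of its class on its machine, and a machine has room for at most T
-- units of setups and jobs; hence large jobs of different classes never share a
-- machine, and a big job (t_j > T/2) is the only large job of its class on its machine.
-- The jobs of an expensive class, the big jobs and the jobs of K are all large, and
-- m_i is at most the number of machines running a large job of class i: each such
-- machine carries at most T - s_i of the load P(C_i) (resp. P(C_i ∩ K)), and for a cheap
-- class the machines of the big jobs are disjoint from those carrying K. Summing over
-- the classes counts every machine at most once.

open import Defs
open import Data.Integer using (+_; _≤_)
open import Data.Rational using (ℚ; 0ℚ) renaming (_<_ to _<ℚ_)
open import Data.Fin using (Fin; zero; suc)
open import Data.Product using (_×_; _,_; ∃; proj₁; proj₂)

open import Algebra.Bundles using (CommutativeMonoid)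
open import Data.Bool as Bool using (Bool; true; false; if_then_else_; _∧_)
import Data.Bool.Properties as BoolP
open import Data.Empty using (⊥; ⊥-elim)
import Data.Fin.Properties as FinP
open FinP using () renaming (_≟_ to _≟ᶠ_)
open import Data.Integer as ℤ using (ℤ; +≤+)
import Data.Integer.DivMod as ℤ
import Data.Integer.Properties as ℤP
open import Data.List using (List; []; _∷_; foldr; map; filter; tabulate; allFin; length)
import Data.List.Properties as ListP
open import Data.List.Relation.Unary.All as All using (All; []; _∷_)
import Data.List.Relation.Unary.All.Properties as AllP
open import Data.List.Relation.Unary.AllPairs using (AllPairs; []; _∷_)
import Data.List.Relation.Unary.AllPairs.Properties as AllPairsP
open import Data.List.Relation.Unary.Unique.Propositional using (Unique)
import Data.List.Relation.Unary.Unique.Propositional.Properties as UniqueP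
open import Data.Nat as ℕ using (ℕ; zero; suc; z≤n; s≤s)
import Data.Nat.Coprimality as Coprime
import Data.Nat.Properties as ℕP
open import Data.Rational as ℚ using (mkℚ; ½; ceiling; _÷_; 1/_)
import Data.Rational.Properties as ℚP
open import Data.Sum using (_⊎_; inj₁; inj₂)
import Data.Sum.Properties as SumP
open import Data.Vec.Functional using (Vector)
open import Function using (_∘_; id)
open import Function.Bundles using (Equivalence)
open import Relation.Binary using (Rel)
open import Relation.Binary.PropositionalEquality as ≡ using (_≡_)
open import Relation.Nullary using (Dec; yes; no; does; ¬_; ¬?)
open import Relation.Nullary.Decidable using (T?; _×-dec_; decidable-stable)
import Relation.Unary as Pred
open import Algebra.Solver.CommutativeMonoid ℚP.+-0-commutativeMonoid using (solve; _⊕_; _⊜_) renaming (id to ∅)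

-- Finite sums

module FinSums {c ℓ} (M : CommutativeMonoid c ℓ) where
  open CommutativeMonoid M renaming (Carrier to R)
  open import Algebra.Properties.CommutativeMonoid.Sum M public using (sum; sum-cong-≗; ∑-comm; ∑-distrib-+)
  open import Algebra.Properties.CommutativeMonoid.Sum M using (sum-cong-≋; sum-replicate-zero)
  open import Relation.Binary.Reasoning.Setoid setoid

  listSum : ∀ {a} {A : Set a} → (A → R) → List A → R
  listSum w xs = foldr _∙_ ε (map w xs)

  listSum-map : ∀ {a b} {A : Set a} {B : Set b} (w : B → R) (f : A → B) xs →
                listSum w (map f xs) ≡ listSum (w ∘ f) xs
  listSum-map w f xs = ≡.cong (foldr _∙_ ε) (≡.sym (ListP.map-∘ xs))

  listSum-tabulate : ∀ {a} {A : Set a} {n} (w : A → R) (g : Fin n → A) →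
                     listSum w (tabulate g) ≡ sum (w ∘ g)
  listSum-tabulate {n = zero}  w g = ≡.refl
  listSum-tabulate {n = suc n} w g = ≡.cong (w (g zero) ∙_) (listSum-tabulate w (g ∘ suc))

  listSum-allFin : ∀ {n} (w : Fin n → R) → listSum w (allFin n) ≡ sum w
  listSum-allFin w = listSum-tabulate w (λ i → i)

  module _ {a p} {A : Set a} {P : Pred.Pred A p} (P? : Pred.Decidable P) (w : A → R) where

    listSum-filter : ∀ xs → listSum w (filter P? xs) ≈ listSum (λ x → if does (P? x) then w x else ε) xs
    listSum-filter []       = refl
    listSum-filter (x ∷ xs) with does (P? x)
    ... | true  = ∙-congˡ (listSum-filter xs)
    ... | false = trans (listSum-filter xs) (sym (identityˡ _))

    listSum-partition : ∀ xs → listSum w xs ≈ listSum w (filter P? xs) ∙ listSum w (filter (¬? ∘ P?) xs)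
    listSum-partition []       = sym (identityˡ ε)
    listSum-partition (x ∷ xs) with does (P? x)
    ... | true  = trans (∙-congˡ (listSum-partition xs)) (sym (assoc _ _ _))
    ... | false = begin
      w x ∙ listSum w xs            ≈⟨ ∙-congˡ (listSum-partition xs) ⟩
      w x ∙ (yes-part ∙ no-part)    ≈⟨ sym (assoc _ _ _) ⟩
      (w x ∙ yes-part) ∙ no-part    ≈⟨ ∙-congʳ (comm (w x) yes-part) ⟩
      (yes-part ∙ w x) ∙ no-part    ≈⟨ assoc _ _ _ ⟩
      yes-part ∙ (w x ∙ no-part)    ∎
      where
      yes-part no-part : R
      yes-part = listSum w (filter P? xs)
      no-part  = listSum w (filter (¬? ∘ P?) xs)

  sum-ε : ∀ {n} {f : Fin n → R} → (∀ i → f i ≈ ε) → sum f ≈ ε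
  sum-ε {n} f≈ε = trans (sum-cong-≋ f≈ε) (sum-replicate-zero n)

  sum-if-≟ : ∀ {k} (a : Fin k) x → sum (λ μ → if does (a ≟ᶠ μ) then x else ε) ≈ x
  sum-if-≟ {suc k} zero    x = trans (∙-congˡ (sum-ε {k} (λ _ → refl))) (identityʳ x)
  sum-if-≟ {suc k} (suc a) x = trans (identityˡ _) (sum-if-≟ a x)

  sum-fibres : ∀ {n k} (f : Fin n → Fin k) (w : Vector R n) →
               sum w ≈ sum (λ μ → sum (λ j → if does (f j ≟ᶠ μ) then w j else ε))
  sum-fibres f w = trans (sum-cong-≋ (λ j → sym (sum-if-≟ (f j) (w j))))
                         (∑-comm (λ j μ → if does (f j ≟ᶠ μ) then w j else ε))

  module Monotone {r} (_≤_ : Rel R r) (ε≤ε : ε ≤ ε)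
           (∙-mono : ∀ {x y u v} → x ≤ y → u ≤ v → (x ∙ u) ≤ (y ∙ v)) where

    sum-mono : ∀ {n} {f g : Vector R n} → (∀ i → f i ≤ g i) → sum f ≤ sum g
    sum-mono {zero}  f≤g = ε≤ε
    sum-mono {suc n} f≤g = ∙-mono (f≤g zero) (sum-mono (f≤g ∘ suc))

module ℕΣ where
  open FinSums ℕP.+-0-commutativeMonoid public
  open Monotone ℕ._≤_ ℕP.≤-refl ℕP.+-mono-≤ public

module ℤΣ where
  open FinSums ℤP.+-0-commutativeMonoid public
  open Monotone ℤ._≤_ ℤP.≤-refl ℤP.+-mono-≤ public

module ℚΣ where
  open FinSums ℚP.+-0-commutativeMonoid public
  open Monotone ℚ._≤_ ℚP.≤-refl ℚP.+-mono-≤ public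

open ≡ using (_≢_; refl; sym; trans; cong; cong₂; subst)

-- Rational arithmetic

ℕ→ℚ-mkℚ : ∀ N → ℕ→ℚ N ≡ mkℚ (+ N) 0 (Coprime.sym (Coprime.1-coprimeTo N))
ℕ→ℚ-mkℚ N = ℚP.normalize-coprime (Coprime.sym (Coprime.1-coprimeTo N))

ℕ→ℚ-suc : ∀ N → ℕ→ℚ (suc N) ≡ ℚ.1ℚ ℚ.+ ℕ→ℚ N
ℕ→ℚ-suc N = sym (trans (cong (ℚ.1ℚ ℚ.+_) (ℕ→ℚ-mkℚ N))
                       (cong (λ z → (+ 1 ℤ.+ z) ℚ./ 1) (ℤP.*-identityʳ (+ N))))

ℕ→ℚ-nonNeg : ∀ N → 0ℚ ℚ.≤ ℕ→ℚ N
ℕ→ℚ-nonNeg N = ℚP.nonNegative⁻¹ (ℕ→ℚ N) {{ℚP.normalize-nonNeg N 1}}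

ceiling-mkℚ : ∀ a d .(c : Coprime.Coprime ℤ.∣ a ∣ (suc d)) →
              ceiling (mkℚ a d c) ≡ ℤ.- ((ℤ.- a) ℤ./ + suc d)
ceiling-mkℚ (+ zero)   d c = refl
ceiling-mkℚ ℤ.+[1+ _ ] d c = refl
ceiling-mkℚ ℤ.-[1+ _ ] d c = refl

ceil-div-≤ : ∀ a i n .{{_ : ℕ.NonZero n}} → a ℤ.≤ i ℤ.* + n → ℤ.- ((ℤ.- a) ℤ./ + n) ℤ.≤ i
ceil-div-≤ a i n a≤in = subst (ℤ.- q ℤ.≤_) (ℤP.neg-involutive i) (ℤP.neg-mono-≤ -i≤q)
  where
  q : ℤ
  q = (ℤ.- a) ℤ./ + n
  -a<[1+q]n : ℤ.- a ℤ.< ℤ.suc q ℤ.* + n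
  -a<[1+q]n = subst (λ r → ℤ.- a ℤ.< ℤ.suc r ℤ.* + n) (sym (ℤ.div-pos-is-/ℕ (ℤ.- a) n))
                (ℤ.n<s[n/ℕd]*d (ℤ.- a) n)
  -in≤-a : ℤ.- i ℤ.* + n ℤ.≤ ℤ.- a
  -in≤-a = subst (ℤ._≤ ℤ.- a) (ℤP.neg-distribˡ-* i (+ n)) (ℤP.neg-mono-≤ a≤in)
  -i≤q : ℤ.- i ℤ.≤ q
  -i≤q = subst (ℤ.- i ℤ.≤_) (ℤP.pred-suc q)
           (ℤP.i<j⇒i≤pred[j] {ℤ.- i} {ℤ.suc q}
             (ℤP.*-cancelʳ-<-nonNeg (+ n) (ℤP.≤-<-trans -in≤-a -a<[1+q]n)))

ceiling-≤ : ∀ p N → p ℚ.≤ ℕ→ℚ N → ceiling p ℤ.≤ + N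
ceiling-≤ p@(mkℚ a d c) N p≤N with subst (p ℚ.≤_) (ℕ→ℚ-mkℚ N) p≤N
... | ℚ.*≤* a*1≤N*n = subst (ℤ._≤ + N) (sym (ceiling-mkℚ a d c))
  (ceil-div-≤ a (+ N) (suc d) (subst (ℤ._≤ + N ℤ.* + suc d) (ℤP.*-identityʳ a) a*1≤N*n))

÷-≤ : ∀ {p} q {r} (q>0 : 0ℚ <ℚ q) → p ℚ.≤ r ℚ.* q → (p ÷ q) {{ℚ.>-nonZero q>0}} ℚ.≤ r
÷-≤ {p} q@(mkℚ ℤ.+[1+ _ ] _ _) {r} _ p≤rq = begin
  p ℚ.* 1/ q           ≤⟨ ℚP.*-monoʳ-≤-nonNeg (1/ q) p≤rq ⟩
  r ℚ.* q ℚ.* 1/ q     ≡⟨ ℚP.*-assoc r q (1/ q) ⟩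
  r ℚ.* (q ℚ.* 1/ q)   ≡⟨ cong (r ℚ.*_) (ℚP.*-inverseʳ q) ⟩
  r ℚ.* ℚ.1ℚ           ≡⟨ ℚP.*-identityʳ r ⟩
  r                    ∎
  where open ℚP.≤-Reasoning
÷-≤ (mkℚ (+ zero)   _ _) (ℚ.*<* (ℤ.+<+ ()))
÷-≤ (mkℚ ℤ.-[1+ _ ] _ _) (ℚ.*<* ())

ceilDiv-≤ : ∀ p q N → (0ℚ <ℚ q → p ℚ.≤ ℕ→ℚ N ℚ.* q) → ceilDiv p q ℤ.≤ + N
ceilDiv-≤ p q N p≤Nq with 0ℚ ℚP.<? q
... | yes q>0 = ceiling-≤ _ N (÷-≤ q q>0 (p≤Nq q>0))
... | no  _   = +≤+ z≤n

p+q≤r⇒q≤r-p : ∀ p q r → p ℚ.+ q ℚ.≤ r → q ℚ.≤ r ℚ.- p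
p+q≤r⇒q≤r-p p q r p+q≤r = begin
  q                    ≡⟨ sym (ℚP.+-identityʳ q) ⟩
  q ℚ.+ 0ℚ             ≡⟨ cong (q ℚ.+_) (sym (ℚP.+-inverseʳ p)) ⟩
  q ℚ.+ (p ℚ.- p)      ≡⟨ sym (ℚP.+-assoc q p (ℚ.- p)) ⟩
  q ℚ.+ p ℚ.- p        ≡⟨ cong (ℚ._- p) (ℚP.+-comm q p) ⟩
  p ℚ.+ q ℚ.- p        ≤⟨ ℚP.+-monoˡ-≤ (ℚ.- p) p+q≤r ⟩
  r ℚ.- p              ∎
  where open ℚP.≤-Reasoning

p≤p+q : ∀ p {q} → 0ℚ ℚ.≤ q → p ℚ.≤ p ℚ.+ q
p≤p+q p {q} 0≤q = subst (ℚ._≤ p ℚ.+ q) (ℚP.+-identityʳ p) (ℚP.+-monoʳ-≤ p 0≤q)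

q≤p+q : ∀ {p} → 0ℚ ℚ.≤ p → ∀ q → q ℚ.≤ p ℚ.+ q
q≤p+q {p} 0≤p q = subst (ℚ._≤ p ℚ.+ q) (ℚP.+-identityˡ q) (ℚP.+-monoˡ-≤ q 0≤p)

halves-exceed : ∀ {T a b} → T ℚ.* ½ <ℚ a → T ℚ.* ½ <ℚ b → T <ℚ a ℚ.+ b
halves-exceed {T} h₁ h₂ = subst (_<ℚ _) T/2+T/2≡T (ℚP.+-mono-< h₁ h₂)
  where
  T/2+T/2≡T : T ℚ.* ½ ℚ.+ T ℚ.* ½ ≡ T
  T/2+T/2≡T = trans (sym (ℚP.*-distribˡ-+ T ½ ½)) (ℚP.*-identityʳ T)

-- Counting

𝟙 : Bool → ℕ
𝟙 b = if b then 1 else 0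

does-complete : ∀ {a} {A : Set a} (d : Dec A) → A → Bool.T (does d)
does-complete (yes _)  _ = _
does-complete (no ¬a) a = ¬a a

does-sound : ∀ {a} {A : Set a} (d : Dec A) → Bool.T (does d) → A
does-sound (yes a) _  = a
does-sound (no _)  ()

if-intro : ∀ {a p} {A : Set a} (P : A → Set p) b {x y} → (Bool.T b → P x) → (¬ Bool.T b → P y) →
           P (if b then x else y)
if-intro P true  px _  = px _
if-intro P false _  py = py id

if-false : ∀ {a} {A : Set a} b {x y : A} → ¬ Bool.T b → (if b then x else y) ≡ y
if-false true  ¬b = ⊥-elim (¬b _)
if-false false _  = refl

𝟙-mono : ∀ {a b} → (Bool.T a → Bool.T b) → 𝟙 a ℕ.≤ 𝟙 b
𝟙-mono {false} _   = z≤n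
𝟙-mono {true} {true}  _   = ℕP.≤-refl
𝟙-mono {true} {false} a⇒b = ⊥-elim (a⇒b _)

countB-sum : ∀ {n} (b : Fin n → Bool) → countB n b ≡ ℕΣ.sum (𝟙 ∘ b)
countB-sum {n} b = trans (count-filter (allFin n)) (ℕΣ.listSum-allFin (𝟙 ∘ b))
  where
  count-filter : ∀ xs → length (filter (λ x → b x BoolP.≟ true) xs) ≡ ℕΣ.listSum (𝟙 ∘ b) xs
  count-filter []       = refl
  count-filter (x ∷ xs) with b x
  ... | true  = cong suc (count-filter xs)
  ... | false = count-filter xs

sum-𝟙-≤ : ∀ {k} (b : Fin k → Bool) {q} → (∀ {x y} → Bool.T (b x) → Bool.T (b y) → x ≡ y) →
          (∀ {x} → Bool.T (b x) → Bool.T q) → ℕΣ.sum (𝟙 ∘ b) ℕ.≤ 𝟙 q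
sum-𝟙-≤ {zero}  b excl imp = z≤n
sum-𝟙-≤ {suc k} b {q} excl imp with b zero in b₀
... | true  = subst (ℕ._≤ 𝟙 q) (cong suc (sym rest≡0)) (𝟙-mono (λ _ → imp b₀-holds))
  where
  b₀-holds : Bool.T (b zero)
  b₀-holds = subst Bool.T (sym b₀) _
  rest≡0 : ℕΣ.sum (𝟙 ∘ b ∘ suc) ≡ 0
  rest≡0 = ℕΣ.sum-ε λ y → lemma y
    where
    lemma : ∀ y → 𝟙 (b (suc y)) ≡ 0
    lemma y with b (suc y) in b₁
    ... | false = refl
    ... | true  with () ← excl b₀-holds (subst Bool.T (sym b₁) _)
... | false = sum-𝟙-≤ (b ∘ suc) (λ bx by → FinP.suc-injective (excl bx by)) imp

sum-if-const : ∀ {k} (b : Fin k → Bool) q →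
               ℚΣ.sum (λ μ → if b μ then q else 0ℚ) ≡ ℕ→ℚ (ℕΣ.sum (𝟙 ∘ b)) ℚ.* q
sum-if-const {zero}  b q = sym (ℚP.*-zeroˡ q)
sum-if-const {suc k} b q with b zero
... | false = trans (ℚP.+-identityˡ _) (sum-if-const (b ∘ suc) q)
... | true  = begin
  q ℚ.+ ℚΣ.sum (λ μ → if b (suc μ) then q else 0ℚ) ≡⟨ cong (q ℚ.+_) (sum-if-const (b ∘ suc) q) ⟩
  q ℚ.+ ℕ→ℚ N ℚ.* q                                 ≡⟨ cong (ℚ._+ ℕ→ℚ N ℚ.* q) (sym (ℚP.*-identityˡ q)) ⟩
  ℚ.1ℚ ℚ.* q ℚ.+ ℕ→ℚ N ℚ.* q                        ≡⟨ sym (ℚP.*-distribʳ-+ q ℚ.1ℚ (ℕ→ℚ N)) ⟩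
  (ℚ.1ℚ ℚ.+ ℕ→ℚ N) ℚ.* q                            ≡⟨ cong (ℚ._* q) (sym (ℕ→ℚ-suc N)) ⟩
  ℕ→ℚ (suc N) ℚ.* q                                 ∎
  where
  open ≡.≡-Reasoning
  N : ℕ
  N = ℕΣ.sum (𝟙 ∘ b ∘ suc)

sum-+ : ∀ {k} (h : Fin k → ℕ) → ℤΣ.sum (+_ ∘ h) ≡ + ℕΣ.sum h
sum-+ {zero}  h = refl
sum-+ {suc k} h = trans (cong (ℤ._+_ (+ h zero)) (sum-+ (h ∘ suc))) (sym (ℤP.pos-+ (h zero) _))

-- Disjoint intervals

module Intervals {A : Set} (start len : A → ℚ) where

  end : A → ℚ
  end x = start x ℚ.+ len x

  Disjoint : A → A → Set
  Disjoint x y = end x ℚ.≤ start y ⊎ end y ℚ.≤ start x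

  Within : ℚ → ℚ → A → Set
  Within lo hi x = lo ℚ.≤ start x × end x ℚ.≤ hi

  totalLength : List A → ℚ
  totalLength = ℚΣ.listSum len

  -- The first interval splits the others into those before and those after it.
  disjoint-within-≤ : ∀ {lo hi} xs → lo ℚ.≤ hi → All (Within lo hi) xs → AllPairs Disjoint xs →
                      lo ℚ.+ totalLength xs ℚ.≤ hi
  disjoint-within-≤ xs = go (length xs) xs ℕP.≤-refl
    where
    go : ∀ k xs {lo hi} → length xs ℕ.≤ k → lo ℚ.≤ hi → All (Within lo hi) xs →
         AllPairs Disjoint xs → lo ℚ.+ totalLength xs ℚ.≤ hi
    go _ [] {lo} _ lo≤hi _ _ = subst (ℚ._≤ _) (sym (ℚP.+-identityʳ lo)) lo≤hi
    go (suc k) (x ∷ xs) {lo} {hi} (s≤s |xs|≤k) _ ((lo≤x , x≤hi) ∷ within) (x#xs ∷ disjoint) = begin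
      lo ℚ.+ (len x ℚ.+ totalLength xs)                  ≡⟨ cong (λ z → lo ℚ.+ (len x ℚ.+ z)) split ⟩
      lo ℚ.+ (len x ℚ.+ (totalLength before ℚ.+ totalLength after))
                                                         ≡⟨ rearrange ⟩
      (lo ℚ.+ totalLength before) ℚ.+ len x ℚ.+ totalLength after
                                                         ≤⟨ ℚP.+-monoˡ-≤ _ (ℚP.+-monoˡ-≤ (len x) before-fits) ⟩
      end x ℚ.+ totalLength after                        ≤⟨ after-fits ⟩
      hi                                                 ∎
      where
      open ℚP.≤-Reasoning hiding (start)
      Before : A → Set
      Before y = end y ℚ.≤ start x
      before? : Pred.Decidable Before
      before? y = end y ℚP.≤? start x
      before after : List A
      before = filter before? xs
      after  = filter (¬? ∘ before?) xs
      split : totalLength xs ≡ totalLength before ℚ.+ totalLength after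
      split = ℚΣ.listSum-partition before? len xs
      rearrange : lo ℚ.+ (len x ℚ.+ (totalLength before ℚ.+ totalLength after)) ≡
                  (lo ℚ.+ totalLength before) ℚ.+ len x ℚ.+ totalLength after
      rearrange = solve 4 (λ a b c d → a ⊕ (b ⊕ (c ⊕ d)) ⊜ ((a ⊕ c) ⊕ b) ⊕ d) refl
                    lo (len x) (totalLength before) (totalLength after)
      after-starts : ∀ {y} → Disjoint x y → ¬ Before y → end x ℚ.≤ start y
      after-starts (inj₁ x≤y) _ = x≤y
      after-starts (inj₂ y≤x) ¬y≤x = ⊥-elim (¬y≤x y≤x)
      before-fits : lo ℚ.+ totalLength before ℚ.≤ start x
      before-fits = go k before (ℕP.≤-trans (ListP.length-filter before? xs) |xs|≤k) lo≤x
        (All.zipWith (λ ((lo≤y , _) , y≤x) → lo≤y , y≤x)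
           (AllP.filter⁺ before? within , AllP.all-filter before? xs))
        (AllPairsP.filter⁺ before? disjoint)
      after-fits : end x ℚ.+ totalLength after ℚ.≤ hi
      after-fits = go k after (ℕP.≤-trans (ListP.length-filter (¬? ∘ before?) xs) |xs|≤k) x≤hi
        (All.zipWith (λ ((_ , y≤hi) , x#y , ¬y≤x) → after-starts x#y ¬y≤x , y≤hi)
           (AllP.filter⁺ (¬? ∘ before?) within ,
            All.zip (AllP.filter⁺ (¬? ∘ before?) x#xs , AllP.all-filter (¬? ∘ before?) xs)))
        (AllPairsP.filter⁺ (¬? ∘ before?) disjoint)

-- Jobs on machines

module MachineAssignment {I : Instance} (σ : Schedule I) where
  open Instance I
  open Schedule σ

  inClass : Fin c → (Fin n → Bool) → Fin n → Bool
  inClass i L j = does (cls j ≟ᶠ i) ∧ L j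

  onMachine : (Fin n → Bool) → Fin m → Fin n → Bool
  onMachine P μ j = does (mach j ≟ᶠ μ) ∧ P j

  occupies : (Fin n → Bool) → Fin m → Bool
  occupies P μ = does (FinP.any? (λ j → T? (onMachine P μ j)))

  machineLoad : (Fin n → Bool) → Fin m → ℚ
  machineLoad P μ = ℚΣ.sum (λ j → if onMachine P μ j then ℕ→ℚ (t j) else 0ℚ)

  machinesWith : (Fin n → Bool) → ℕ
  machinesWith P = ℕΣ.sum (𝟙 ∘ occupies P)

  module _ {P : Fin n → Bool} {μ : Fin m} where

    onMachine-intro : ∀ {j} → mach j ≡ μ → Bool.T (P j) → Bool.T (onMachine P μ j)
    onMachine-intro {j} j∈μ Pj = Equivalence.from BoolP.T-∧ (does-complete (mach j ≟ᶠ μ) j∈μ , Pj)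

    onMachine-elim : ∀ {j} → Bool.T (onMachine P μ j) → mach j ≡ μ × Bool.T (P j)
    onMachine-elim {j} onμ = let j∈μ , Pj = Equivalence.to BoolP.T-∧ onμ in does-sound (mach j ≟ᶠ μ) j∈μ , Pj

    occupies-intro : ∀ j → Bool.T (onMachine P μ j) → Bool.T (occupies P μ)
    occupies-intro j onμ = does-complete (FinP.any? _) (j , onμ)

    occupies-elim : Bool.T (occupies P μ) → ∃ λ j → Bool.T (onMachine P μ j)
    occupies-elim = does-sound (FinP.any? _)

  inClass-intro : ∀ {i L j} → cls j ≡ i → Bool.T (L j) → Bool.T (inClass i L j)
  inClass-intro {i} {j = j} j∈i Lj = Equivalence.from BoolP.T-∧ (does-complete (cls j ≟ᶠ i) j∈i , Lj)

  inClass-elim : ∀ {i L j} → Bool.T (inClass i L j) → cls j ≡ i × Bool.T (L j)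
  inClass-elim {i} {j = j} j∈iL = let j∈i , Lj = Equivalence.to BoolP.T-∧ j∈iL in does-sound (cls j ≟ᶠ i) j∈i , Lj

  onMachine-mono : ∀ {P Q μ j} → (∀ {j} → Bool.T (P j) → Bool.T (Q j)) →
                   Bool.T (onMachine P μ j) → Bool.T (onMachine Q μ j)
  onMachine-mono {P} {Q} P⇒Q onμ = let j∈μ , Pj = onMachine-elim {P} onμ in onMachine-intro {Q} j∈μ (P⇒Q Pj)

  occupies-mono : ∀ {P Q μ} → (∀ {j} → Bool.T (P j) → Bool.T (Q j)) →
                  Bool.T (occupies P μ) → Bool.T (occupies Q μ)
  occupies-mono {P} {Q} {μ} P⇒Q occ =
    let j , onμ = occupies-elim {P} {μ} occ in occupies-intro {Q} j (onMachine-mono {P} {Q} P⇒Q onμ)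

  inClass-mono : ∀ {i L L′ j} → (∀ {j} → cls j ≡ i → Bool.T (L j) → Bool.T (L′ j)) →
                 Bool.T (inClass i L j) → Bool.T (inClass i L′ j)
  inClass-mono {i} {L} {L′} L⇒L′ j∈iL = let j∈i , Lj = inClass-elim {i} {L} j∈iL in inClass-intro {i} {L′} j∈i (L⇒L′ j∈i Lj)

  module _ {a ℓ} (M : CommutativeMonoid a ℓ) where
    open CommutativeMonoid M using (Carrier; _≈_; ε)
    open FinSums M

    sum-by-machine : ∀ (P : Fin n → Bool) (w : Fin n → Carrier) →
      sum (λ j → if P j then w j else ε) ≈ sum (λ μ → sum (λ j → if onMachine P μ j then w j else ε))
    sum-by-machine P w = M.trans (sum-fibres mach (λ j → if P j then w j else ε))
      (M.reflexive (sum-cong-≗ λ μ → sum-cong-≗ λ j → sym (BoolP.if-∧ (does (mach j ≟ᶠ μ)))))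
      where module M = CommutativeMonoid M

module _ (I : Instance) (T : ℚ) where
  open Instance I

  mBound-cases : ∀ i {N} →
    (Bool.T (expensive I T i) → ceilDiv (loadIn I T i (λ _ → true)) (T ℚ.- ℕ→ℚ (s i)) ℤ.≤ + N) →
    (¬ Bool.T (expensive I T i) →
       + countB n (λ j → does (cls j ≟ᶠ i) ∧ big I T j) ℤ.+ ceilDiv (loadIn I T i (inK I T)) (T ℚ.- ℕ→ℚ (s i))
         ℤ.≤ + N) →
    mBound I T i ℤ.≤ + N
  mBound-cases i with expensive I T i
  ... | true  = λ expensive-case _ → expensive-case _
  ... | false = λ _ cheap-case → cheap-case id

-- A feasible schedule of makespan T

module FeasibleSchedule (I : Instance) (T : ℚ) (T>0 : 0ℚ <ℚ T) (σ : Schedule I)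
                        (feasible : FeasibleWithMakespan σ T) where
  open Instance I
  open Schedule σ
  open MachineAssignment σ
  open Intervals (iStart σ) (iLen σ)

  within : ∀ x → Within 0ℚ T x
  within = proj₁ feasible

  one-at-a-time : ∀ x y → x ≢ y → iMach σ x ≡ iMach σ y → Disjoint x y
  one-at-a-time = proj₁ (proj₂ feasible)

  setupOf : Fin n → Fin nset
  setupOf j = proj₁ (proj₁ (proj₂ (proj₂ feasible)) j)

  setupOf-machine : ∀ j → smach (setupOf j) ≡ mach j
  setupOf-machine j = proj₁ (proj₂ (proj₁ (proj₂ (proj₂ feasible)) j))

  setupOf-class : ∀ j → scls (setupOf j) ≡ cls j
  setupOf-class j = proj₁ (proj₂ (proj₂ (proj₁ (proj₂ (proj₂ feasible)) j)))

  setupOf-length : ∀ j → iLen σ (inj₂ (setupOf j)) ≡ ℕ→ℚ (s (cls j))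
  setupOf-length j = cong (ℕ→ℚ ∘ s) (setupOf-class j)

  machine-capacity : ∀ μ xs → All (λ x → iMach σ x ≡ μ) xs → Unique xs → totalLength xs ℚ.≤ T
  machine-capacity μ xs on-μ unique = subst (ℚ._≤ T) (ℚP.+-identityˡ _)
    (disjoint-within-≤ xs (ℚP.<⇒≤ T>0) (All.universal within xs) (pairwise-disjoint xs on-μ unique))
    where
    pairwise-disjoint : ∀ xs → All (λ x → iMach σ x ≡ μ) xs → Unique xs → AllPairs Disjoint xs
    pairwise-disjoint []       _                 _                  = []
    pairwise-disjoint (x ∷ xs) (x-on-μ ∷ on-μ) (x∉xs ∷ unique) =
      All.zipWith (λ { {y} (y-on-μ , x≢y) → one-at-a-time x y x≢y (trans x-on-μ (sym y-on-μ)) })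
                  (on-μ , x∉xs)
      ∷ pairwise-disjoint xs on-μ unique

  different-classes : ∀ {x y} → iClass σ x ≢ iClass σ y → x ≢ y
  different-classes x≉y refl = x≉y refl

  Large : Fin n → Set
  Large j = T ℚ.* ½ <ℚ ℕ→ℚ (s (cls j)) ℚ.+ ℕ→ℚ (t j)

  large-job-excludes-other-classes : ∀ {j j′} → cls j ≢ cls j′ → mach j ≡ mach j′ → Large j → Large j′ → ⊥
  large-job-excludes-other-classes {j} {j′} different j~j′ large large' = ℚP.<-irrefl refl
    (ℚP.<-≤-trans overfull (machine-capacity (mach j) items on-machine distinct))
    where
    items = inj₂ (setupOf j) ∷ inj₁ j ∷ inj₂ (setupOf j′) ∷ inj₁ j′ ∷ []
    on-machine : All (λ x → iMach σ x ≡ mach j) items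
    on-machine = setupOf-machine j ∷ refl ∷ trans (setupOf-machine j′) (sym j~j′) ∷ sym j~j′ ∷ []
    distinct : Unique items
    distinct = ((λ ()) ∷ different-classes setups-differ ∷ (λ ()) ∷ [])
             ∷ ((λ ()) ∷ different-classes different ∷ [])
             ∷ ((λ ()) ∷ [])
             ∷ [] ∷ []
      where
      setups-differ : scls (setupOf j) ≢ scls (setupOf j′)
      setups-differ e = different (trans (sym (setupOf-class j)) (trans e (setupOf-class j′)))
    overfull : T <ℚ totalLength items
    overfull = subst (T <ℚ_) (begin
      (ℕ→ℚ (s (cls j)) ℚ.+ ℕ→ℚ (t j)) ℚ.+ (ℕ→ℚ (s (cls j′)) ℚ.+ ℕ→ℚ (t j′))
        ≡⟨ cong₂ (λ a b → (a ℚ.+ _) ℚ.+ (b ℚ.+ _)) (sym (setupOf-length j)) (sym (setupOf-length j′)) ⟩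
      (iLen σ (inj₂ (setupOf j)) ℚ.+ ℕ→ℚ (t j)) ℚ.+ (iLen σ (inj₂ (setupOf j′)) ℚ.+ ℕ→ℚ (t j′))
        ≡⟨ solve 4 (λ a b c d → (a ⊕ b) ⊕ (c ⊕ d) ⊜ a ⊕ (b ⊕ (c ⊕ (d ⊕ ∅)))) refl
             (iLen σ (inj₂ (setupOf j))) (ℕ→ℚ (t j)) (iLen σ (inj₂ (setupOf j′))) (ℕ→ℚ (t j′)) ⟩
      totalLength items ∎) (halves-exceed large large')
      where open ≡.≡-Reasoning

  large-jobs-share-class : ∀ {j j′} → mach j ≡ mach j′ → Large j → Large j′ → cls j ≡ cls j′
  large-jobs-share-class {j} {j′} j~j′ large large' =
    decidable-stable (cls j ≟ᶠ cls j′) λ different → large-job-excludes-other-classes different j~j′ large large'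

  big-job-excludes-large : ∀ {j j′} → j ≢ j′ → mach j ≡ mach j′ → cls j ≡ cls j′ →
                           T ℚ.* ½ <ℚ ℕ→ℚ (t j) → Large j′ → ⊥
  big-job-excludes-large {j} {j′} j≢j′ j~j′ same big large' = ℚP.<-irrefl refl
    (ℚP.<-≤-trans overfull (machine-capacity (mach j) items on-machine distinct))
    where
    items = inj₂ (setupOf j) ∷ inj₁ j ∷ inj₁ j′ ∷ []
    on-machine : All (λ x → iMach σ x ≡ mach j) items
    on-machine = setupOf-machine j ∷ refl ∷ sym j~j′ ∷ []
    distinct : Unique items
    distinct = ((λ ()) ∷ (λ ()) ∷ []) ∷ ((j≢j′ ∘ SumP.inj₁-injective) ∷ []) ∷ [] ∷ []
    overfull : T <ℚ totalLength items
    overfull = subst (T <ℚ_) (begin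
      ℕ→ℚ (t j) ℚ.+ (ℕ→ℚ (s (cls j′)) ℚ.+ ℕ→ℚ (t j′))
        ≡⟨ cong (λ a → ℕ→ℚ (t j) ℚ.+ (a ℚ.+ _)) (sym (trans (setupOf-length j) (cong (ℕ→ℚ ∘ s) same))) ⟩
      ℕ→ℚ (t j) ℚ.+ (iLen σ (inj₂ (setupOf j)) ℚ.+ ℕ→ℚ (t j′))
        ≡⟨ solve 3 (λ a b c → b ⊕ (a ⊕ c) ⊜ a ⊕ (b ⊕ (c ⊕ ∅))) refl
             (iLen σ (inj₂ (setupOf j))) (ℕ→ℚ (t j)) (ℕ→ℚ (t j′)) ⟩
      totalLength items ∎) (halves-exceed big large')
      where open ≡.≡-Reasoning

  setup-and-jobs-≤ : ∀ P μ k → smach k ≡ μ →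
    ℕ→ℚ (s (scls k)) ℚ.+ machineLoad P μ ℚ.≤ T
  setup-and-jobs-≤ P μ k k-on-μ = subst (ℚ._≤ T) total (machine-capacity μ items on-machine distinct)
    where
    jobs : List (Fin n)
    jobs = filter (λ j → T? (onMachine P μ j)) (allFin n)
    items : List (Item σ)
    items = inj₂ k ∷ map inj₁ jobs
    on-machine : All (λ x → iMach σ x ≡ μ) items
    on-machine = k-on-μ ∷ AllP.map⁺ (All.map (λ onμ → proj₁ (onMachine-elim {P} onμ))
                                             (AllP.all-filter (λ j → T? (onMachine P μ j)) (allFin n)))
    distinct : Unique items
    distinct = AllP.map⁺ (All.universal (λ _ ()) jobs)
             ∷ UniqueP.map⁺ SumP.inj₁-injective (UniqueP.filter⁺ _ (UniqueP.allFin⁺ n))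
    total : totalLength items ≡ ℕ→ℚ (s (scls k)) ℚ.+ machineLoad P μ
    total = cong (ℕ→ℚ (s (scls k)) ℚ.+_) (begin
      ℚΣ.listSum (iLen σ) (map inj₁ jobs)    ≡⟨ ℚΣ.listSum-map (iLen σ) inj₁ jobs ⟩
      ℚΣ.listSum (ℕ→ℚ ∘ t) jobs             ≡⟨ ℚΣ.listSum-filter (λ j → T? (onMachine P μ j)) (ℕ→ℚ ∘ t) (allFin n) ⟩
      ℚΣ.listSum (λ j → if onMachine P μ j then ℕ→ℚ (t j) else 0ℚ) (allFin n)
                                              ≡⟨ ℚΣ.listSum-allFin (λ j → if onMachine P μ j then ℕ→ℚ (t j) else 0ℚ) ⟩
      machineLoad P μ ∎)
      where open ≡.≡-Reasoning

  machine-load-≤ : ∀ i L μ →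
    machineLoad (inClass i L) μ ℚ.≤ (if occupies (inClass i L) μ then T ℚ.- ℕ→ℚ (s i) else 0ℚ)
  machine-load-≤ i L μ = if-intro (ℚ._≤_ (machineLoad (inClass i L) μ)) (occupies (inClass i L) μ) loaded idle
    where
    loaded : Bool.T (occupies (inClass i L) μ) → machineLoad (inClass i L) μ ℚ.≤ T ℚ.- ℕ→ℚ (s i)
    loaded occ =
      let j , onμ    = occupies-elim {inClass i L} occ
          j∈μ , j∈iL = onMachine-elim {inClass i L} onμ
          j∈i , _    = inClass-elim {i} {L} j∈iL
      in p+q≤r⇒q≤r-p _ _ T (subst (λ z → ℕ→ℚ (s z) ℚ.+ machineLoad (inClass i L) μ ℚ.≤ T) (trans (setupOf-class j) j∈i)
                             (setup-and-jobs-≤ (inClass i L) μ (setupOf j) (trans (setupOf-machine j) j∈μ)))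
    idle : ¬ Bool.T (occupies (inClass i L) μ) → machineLoad (inClass i L) μ ℚ.≤ 0ℚ
    idle free = ℚP.≤-reflexive (ℚΣ.sum-ε λ j → if-false (onMachine (inClass i L) μ j)
                                                   (free ∘ occupies-intro {inClass i L} j))

  classLoad-≤ : ∀ i L → ceilDiv (loadIn I T i L) (T ℚ.- ℕ→ℚ (s i)) ℤ.≤ + machinesWith (inClass i L)
  classLoad-≤ i L = ceilDiv-≤ _ _ _ λ _ → begin
    loadIn I T i L                                            ≡⟨ ℚΣ.listSum-allFin (λ j → if inClass i L j then ℕ→ℚ (t j) else 0ℚ) ⟩
    ℚΣ.sum (λ j → if inClass i L j then ℕ→ℚ (t j) else 0ℚ)   ≡⟨ sum-by-machine ℚP.+-0-commutativeMonoid (inClass i L) (ℕ→ℚ ∘ t) ⟩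
    ℚΣ.sum (machineLoad (inClass i L))                        ≤⟨ ℚΣ.sum-mono (machine-load-≤ i L) ⟩
    ℚΣ.sum (λ μ → if occupies (inClass i L) μ then q else 0ℚ) ≡⟨ sum-if-const (occupies (inClass i L)) q ⟩
    ℕ→ℚ (machinesWith (inClass i L)) ℚ.* q                    ∎
    where
    open ℚP.≤-Reasoning
    q : ℚ
    q = T ℚ.- ℕ→ℚ (s i)

  large : Fin n → Bool
  large j = does (T ℚ.* ½ ℚP.<? ℕ→ℚ (s (cls j)) ℚ.+ ℕ→ℚ (t j))

  large-sound : ∀ {j} → Bool.T (large j) → Large j
  large-sound {j} = does-sound (T ℚ.* ½ ℚP.<? ℕ→ℚ (s (cls j)) ℚ.+ ℕ→ℚ (t j))

  large-complete : ∀ {j} → Large j → Bool.T (large j)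
  large-complete {j} = does-complete (T ℚ.* ½ ℚP.<? ℕ→ℚ (s (cls j)) ℚ.+ ℕ→ℚ (t j))

  big-sound : ∀ {j} → Bool.T (big I T j) → T ℚ.* ½ <ℚ ℕ→ℚ (t j)
  big-sound {j} = does-sound (T ℚ.* ½ ℚP.<? ℕ→ℚ (t j))

  expensive⇒large : ∀ {j} → Bool.T (expensive I T (cls j)) → Bool.T (large j)
  expensive⇒large {j} exp = large-complete (ℚP.<-≤-trans
    (does-sound (T ℚ.* ½ ℚP.<? ℕ→ℚ (s (cls j))) exp) (p≤p+q _ (ℕ→ℚ-nonNeg (t j))))

  big⇒large : ∀ {j} → Bool.T (big I T j) → Bool.T (large j)
  big⇒large {j} bigj = large-complete (ℚP.<-≤-trans
    (big-sound bigj) (q≤p+q (ℕ→ℚ-nonNeg (s (cls j))) _))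

  inK⇒large×¬big : ∀ {j} → Bool.T (inK I T j) → Bool.T (large j) × ¬ Bool.T (big I T j)
  inK⇒large×¬big {j} K =
    let _ , K′ = Equivalence.to (BoolP.T-∧ {Bool.not (expensive I T (cls j))}) K
        ¬big , l = Equivalence.to (BoolP.T-∧ {Bool.not (big I T j)} {large j}) K′
    in l , subst Bool.T (Equivalence.to BoolP.T-not-≡ ¬big)

  big-job-alone : ∀ {i μ j j′} → Bool.T (onMachine (inClass i (big I T)) μ j) →
                  Bool.T (onMachine (inClass i large) μ j′) → j ≡ j′
  big-job-alone {i} {μ} {j} {j′} big-j large-j′ = decidable-stable (j ≟ᶠ j′) λ j≢j′ →
    let j∈μ  , j∈i,big    = onMachine-elim {inClass i (big I T)} big-j
        j′∈μ , j′∈i,large = onMachine-elim {inClass i large} large-j′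
        j∈i  , bigj       = inClass-elim {i} {big I T} j∈i,big
        j′∈i , largej′    = inClass-elim {i} {large} j′∈i,large
    in big-job-excludes-large j≢j′ (trans j∈μ (sym j′∈μ)) (trans j∈i (sym j′∈i))
                              (big-sound bigj) (large-sound largej′)

  -- A big job is the only large job of its class on its machine, so μ is counted at most once on the left.
  cheap-machine : ∀ i μ → 𝟙 (occupies (inClass i (inK I T)) μ) ℕ.+ ℕΣ.sum (𝟙 ∘ onMachine (inClass i (big I T)) μ)
                          ℕ.≤ 𝟙 (occupies (inClass i large) μ)
  cheap-machine i μ = sum-𝟙-≤ claims (λ {x} {y} → exclusive {x} {y}) (λ {x} → holds-large {x})
    where
    claims : Fin (suc n) → Bool
    claims zero    = occupies (inClass i (inK I T)) μ
    claims (suc j) = onMachine (inClass i (big I T)) μ j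
    K⇒large : ∀ {j} → Bool.T (inClass i (inK I T) j) → Bool.T (inClass i large j)
    K⇒large = inClass-mono {i} {inK I T} λ _ K → proj₁ (inK⇒large×¬big K)
    Big⇒large : ∀ {j} → Bool.T (inClass i (big I T) j) → Bool.T (inClass i large j)
    Big⇒large = inClass-mono {i} {big I T} λ _ → big⇒large
    K-not-beside-big : ∀ {j} → Bool.T (occupies (inClass i (inK I T)) μ) → ¬ Bool.T (onMachine (inClass i (big I T)) μ j)
    K-not-beside-big {j} K big-j =
      let j′ , K-j′ = occupies-elim {inClass i (inK I T)} K
          j≡j′     = big-job-alone big-j (onMachine-mono {inClass i (inK I T)} K⇒large K-j′)
          _ , Kj′  = inClass-elim {i} {inK I T} (proj₂ (onMachine-elim {inClass i (inK I T)} K-j′))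
          _ , bigj = inClass-elim {i} {big I T} (proj₂ (onMachine-elim {inClass i (big I T)} big-j))
      in proj₂ (inK⇒large×¬big Kj′) (subst (Bool.T ∘ big I T) j≡j′ bigj)
    exclusive : ∀ {x y} → Bool.T (claims x) → Bool.T (claims y) → x ≡ y
    exclusive {zero}  {zero}   _     _      = refl
    exclusive {zero}  {suc _}  K     big-j  = ⊥-elim (K-not-beside-big K big-j)
    exclusive {suc _} {zero}   big-j K      = ⊥-elim (K-not-beside-big K big-j)
    exclusive {suc _} {suc _}  big-j big-j′ =
      cong suc (big-job-alone big-j (onMachine-mono {inClass i (big I T)} Big⇒large big-j′))
    holds-large : ∀ {x} → Bool.T (claims x) → Bool.T (occupies (inClass i large) μ)
    holds-large {zero}  K     = occupies-mono {inClass i (inK I T)} K⇒large K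
    holds-large {suc j} big-j = occupies-intro {inClass i large} j (onMachine-mono {inClass i (big I T)} Big⇒large big-j)

  largeMachines : Fin c → ℕ
  largeMachines i = machinesWith (inClass i large)

  cheap-class-≤ : ∀ i → countB n (inClass i (big I T)) ℕ.+ machinesWith (inClass i (inK I T)) ℕ.≤ largeMachines i
  cheap-class-≤ i = begin
    countB n Big ℕ.+ machinesWith K
      ≡⟨ ℕP.+-comm (countB n Big) (machinesWith K) ⟩
    machinesWith K ℕ.+ countB n Big
      ≡⟨ cong (machinesWith K ℕ.+_) (trans (countB-sum Big) (sum-by-machine ℕP.+-0-commutativeMonoid Big (λ _ → 1))) ⟩
    ℕΣ.sum (𝟙 ∘ occupies K) ℕ.+ ℕΣ.sum (λ μ → ℕΣ.sum (𝟙 ∘ onMachine Big μ))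
      ≡⟨ sym (ℕΣ.∑-distrib-+ (𝟙 ∘ occupies K) (λ μ → ℕΣ.sum (𝟙 ∘ onMachine Big μ))) ⟩
    ℕΣ.sum (λ μ → 𝟙 (occupies K μ) ℕ.+ ℕΣ.sum (𝟙 ∘ onMachine Big μ))
      ≤⟨ ℕΣ.sum-mono (cheap-machine i) ⟩
    largeMachines i ∎
    where
    open ℕP.≤-Reasoning
    Big K : Fin n → Bool
    Big = inClass i (big I T)
    K   = inClass i (inK I T)

  mBound-≤ : ∀ i → mBound I T i ℤ.≤ + largeMachines i
  mBound-≤ i = mBound-cases I T i expensive-case cheap-case
    where
    Big K : Fin n → Bool
    Big = inClass i (big I T)
    K   = inClass i (inK I T)
    expensive-case : Bool.T (expensive I T i) →
                     ceilDiv (loadIn I T i (λ _ → true)) (T ℚ.- ℕ→ℚ (s i)) ℤ.≤ + largeMachines i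
    expensive-case exp = ℤP.≤-trans (classLoad-≤ i (λ _ → true))
      (+≤+ (ℕΣ.sum-mono λ μ → 𝟙-mono (occupies-mono {inClass i (λ _ → true)} {μ = μ} all-large)))
      where
      all-large : ∀ {j} → Bool.T (inClass i (λ _ → true) j) → Bool.T (inClass i large j)
      all-large = inClass-mono {i} {λ _ → true} λ j∈i _ →
        expensive⇒large (subst (Bool.T ∘ expensive I T) (sym j∈i) exp)
    cheap-case : ¬ Bool.T (expensive I T i) →
                 + countB n Big ℤ.+ ceilDiv (loadIn I T i (inK I T)) (T ℚ.- ℕ→ℚ (s i)) ℤ.≤ + largeMachines i
    cheap-case _ = begin
      + countB n Big ℤ.+ ceilDiv (loadIn I T i (inK I T)) (T ℚ.- ℕ→ℚ (s i))
        ≤⟨ ℤP.+-monoʳ-≤ (+ countB n Big) (classLoad-≤ i (inK I T)) ⟩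
      + countB n Big ℤ.+ + machinesWith K
        ≡⟨ sym (ℤP.pos-+ (countB n Big) (machinesWith K)) ⟩
      + (countB n Big ℕ.+ machinesWith K)
        ≤⟨ +≤+ (cheap-class-≤ i) ⟩
      + largeMachines i ∎
      where open ℤP.≤-Reasoning

  large-witness : ∀ {i μ} → Bool.T (occupies (inClass i large) μ) →
                  ∃ λ j → mach j ≡ μ × cls j ≡ i × Large j
  large-witness {i} {μ} occ =
    let j , onμ      = occupies-elim {inClass i large} {μ} occ
        j∈μ , j∈iL   = onMachine-elim {inClass i large} onμ
        j∈i , largej = inClass-elim {i} {large} j∈iL
    in j , j∈μ , j∈i , large-sound largej

  largeMachines-≤-machinesFor : ∀ i → largeMachines i ℕ.≤ machinesFor σ i
  largeMachines-≤-machinesFor i = subst (largeMachines i ℕ.≤_) (sym (countB-sum (usesFor σ i)))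
    (ℕΣ.sum-mono λ μ → 𝟙-mono λ occ →
      let j , j∈μ , j∈i , _ = large-witness occ
      in does-complete (FinP.any? (λ j → (cls j ≟ᶠ i) ×-dec (mach j ≟ᶠ μ))) (j , j∈i , j∈μ))

  classes-per-machine : ∀ μ → ℕΣ.sum (λ i → 𝟙 (occupies (inClass i large) μ)) ℕ.≤ 𝟙 (uses σ μ)
  classes-per-machine μ = sum-𝟙-≤ (λ i → occupies (inClass i large) μ) same-class in-use
    where
    same-class : ∀ {x y} → Bool.T (occupies (inClass x large) μ) → Bool.T (occupies (inClass y large) μ) → x ≡ y
    same-class occ occ′ =
      let j  , j∈μ  , j∈x  , large-j  = large-witness occ
          j′ , j′∈μ , j′∈y , large-j′ = large-witness occ′
      in trans (sym j∈x) (trans (large-jobs-share-class (trans j∈μ (sym j′∈μ)) large-j large-j′) j′∈y)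
    in-use : ∀ {x} → Bool.T (occupies (inClass x large) μ) → Bool.T (uses σ μ)
    in-use occ = let j , j∈μ , _ = large-witness occ in does-complete (FinP.any? (λ j → mach j ≟ᶠ μ)) (j , j∈μ)

lemmaD4 : (I : Instance) (T : ℚ) → 0ℚ <ℚ T → (σ : Schedule I) →
    FeasibleWithMakespan σ T →
    ((i : Fin (Instance.c I)) → mBound I T i ≤ + machinesFor σ i)
    × (sumℤ (Instance.c I) (mBound I T) ≤ + machinesUsed σ)
lemmaD4 I T T>0 σ feasible = per-class , in-total
  where
  open Instance I using (c)
  open MachineAssignment σ
  open FeasibleSchedule I T T>0 σ feasible

  per-class : ∀ i → mBound I T i ≤ + machinesFor σ i
  per-class i = ℤP.≤-trans (mBound-≤ i) (+≤+ (largeMachines-≤-machinesFor i))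

  in-total : sumℤ c (mBound I T) ≤ + machinesUsed σ
  in-total = begin
    sumℤ c (mBound I T)                    ≡⟨ ℤΣ.listSum-allFin (mBound I T) ⟩
    ℤΣ.sum (mBound I T)                    ≤⟨ ℤΣ.sum-mono mBound-≤ ⟩
    ℤΣ.sum (+_ ∘ largeMachines)            ≡⟨ sum-+ largeMachines ⟩
    + ℕΣ.sum largeMachines                 ≡⟨ cong +_ (ℕΣ.∑-comm (λ i μ → 𝟙 (occupies (inClass i large) μ))) ⟩
    + ℕΣ.sum (λ μ → ℕΣ.sum (λ i → 𝟙 (occupies (inClass i large) μ)))
                                           ≤⟨ +≤+ (ℕΣ.sum-mono classes-per-machine) ⟩
    + ℕΣ.sum (𝟙 ∘ uses σ)                  ≡⟨ cong +_ (sym (countB-sum (uses σ))) ⟩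
    + machinesUsed σ                       ∎
    where open ℤP.≤-Reasoning
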